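{- Let $d$ be a positive integer divisible by $3$. Then there exists a partition of $[5]^d$ into $25^{d/3}\leq 2.93^d$ odd proper sub-boxes.
   Context: For finite sets $A_1,\dots,A_d$ with $|A_i|\ge 2$, the set $A=A_1\times\cdots\times A_d$ is a $d$-dimensional discrete box. A sub-box of $A$ is a set $B=B_1\times\cdots\times B_d$ with $B_i\subseteq A_i$ for all $i$; it is proper if $B_i\neq A_i$ for every $i$, and odd if $|B_i|$ is odd for every $i$. Here $[5]=\{1,2,3,4,5\}$ and $[5]^d=[5]\times\cdots\times[5]$ ($d$ factors). A partition means the sub-boxes are pairwise disjoint and their union is the whole box. -}

module Defs where

open import Data.Nat using (ℕ; suc; _+_; _*_)
open import Data.Fin using (Fin)
open import Data.Fin.Subset using (Subset; _∈_; ∣_∣; ⊤)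
open import Data.Product using (Σ; _×_; ∃-syntax)
open import Relation.Binary.PropositionalEquality using (_≡_; _≢_)

-- The discrete box [5]^d : a point is a function  Fin d → Fin 5
-- (Fin 5 plays the role of [5] = {1,...,5}).
Point : ℕ → Set
Point d = Fin d → Fin 5

Box : ℕ → Set
Box d = Fin d → Subset 5

_∈Box_ : ∀ {d} → Point d → Box d → Set
p ∈Box B = ∀ i → p i ∈ B i

Proper : ∀ {d} → Box d → Set
Proper B = ∀ i → B i ≢ ⊤

Odd : ℕ → Set
Odd n = ∃[ m ] (n ≡ 1 + 2 * m)

OddBox : ∀ {d} → Box d → Set
OddBox B = ∀ i → Odd ∣ B i ∣

IsPartition : ∀ {d m} → (Fin m → Box d) → Set
IsPartition {d} {m} F =
  (∀ (p : Point d) → ∃[ j ] (p ∈Box F j)) ×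
  (∀ (p : Point d) (j k : Fin m) → p ∈Box F j → p ∈Box F k → j ≡ k)

module Submission where

-- A partition of [5]^3 into 25 odd proper sub-boxes, raised to the
-- (d/3)-th power, gives the theorem.
--
-- If F partitions [5]^a into m sub-boxes and G partitions
--    [5]^b into n sub-boxes, then the boxes B × C (B ∈ F, C ∈ G) partition
--    [5]^(a+b) into m·n sub-boxes; being odd and proper are coordinatewise
--    conditions, so they pass to the product.  Iterating, an odd proper
--    partition of [5]^a into m boxes yields one of [5]^(q·a) into m^q boxes.
-- 2. Finite verification.  Whether a given finite family of sub-boxes of
--    [5]^d is an odd proper partition is decidable, because points of [5]^d
--    range over a finite set.  This certifies an explicit family of 25 odd
--    proper boxes in [5]^3, so the base case is checked by evaluation.
-- 3. For d = 3q the theorem is the q-th power of the base partition.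

open import Defs
open import Data.Nat using (ℕ; zero; suc; _+_; _*_; _^_; _/_; _>_)
open import Data.Nat.Properties using (*-suc; suc-injective)
open import Data.Nat.Divisibility using (_∣_; divides)
open import Data.Nat.DivMod using (m*n/n≡m)
open import Data.Bool.Properties using () renaming (_≟_ to _≟ᵇ_)
open import Data.Fin using (Fin; zero; suc; splitAt; _↑ˡ_; _↑ʳ_; remQuot; combine)
open import Data.Fin.Properties using (all?; any?; splitAt-↑ˡ; splitAt-↑ʳ; splitAt⁻¹-↑ˡ; splitAt⁻¹-↑ʳ; combine-remQuot; remQuot-combine; _≟_)
open import Data.Fin.Subset using (Subset; inside; outside; ⊤; _∈_; ∣_∣)
open import Data.Fin.Subset.Properties using (_∈?_)
open import Data.Vec using (Vec; []; _∷_; lookup)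
open import Data.Vec.Properties using (≡-dec)
import Data.Vec.Functional as Point
open import Data.Product using (_×_; ∃-syntax; _,_; proj₁; proj₂)
open import Data.Sum using ([_,_]′; inj₁; inj₂)
open import Relation.Nullary using (Dec; yes; no; ¬?; _×-dec_; _→-dec_; map′)
open import Relation.Nullary.Decidable using (toWitness)
open import Function using (_∘_)
open import Relation.Binary.PropositionalEquality using (_≡_; _≢_; refl; sym; trans; cong; cong₂; subst; module ≡-Reasoning)

OddProperPartition : ℕ → ℕ → Set
OddProperPartition d m =
  ∃[ F ] (IsPartition {d} {m} F × (∀ j → OddBox (F j)) × (∀ j → Proper (F j)))

_⊗_ : ∀ {a b} → Box a → Box b → Box (a + b)
_⊗_ {a} B C i = [ B , C ]′ (splitAt a i)

left : ∀ {a b} → Point (a + b) → Point a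
left {b = b} p i = p (i ↑ˡ b)

right : ∀ {a b} → Point (a + b) → Point b
right {a} p i = p (a ↑ʳ i)

∈⊗⁻ : ∀ {a b} (B : Box a) (C : Box b) {p : Point (a + b)} →
      p ∈Box (B ⊗ C) → left {a} p ∈Box B × right {a} p ∈Box C
∈⊗⁻ {a} {b} B C {p} p∈ =
  (λ i → subst (λ s → p (i ↑ˡ b) ∈ [ B , C ]′ s) (splitAt-↑ˡ a i b) (p∈ (i ↑ˡ b))) ,
  (λ i → subst (λ s → p (a ↑ʳ i) ∈ [ B , C ]′ s) (splitAt-↑ʳ a b i) (p∈ (a ↑ʳ i)))

∈⊗⁺ : ∀ {a b} (B : Box a) (C : Box b) {p : Point (a + b)} →
      left {a} p ∈Box B → right {a} p ∈Box C → p ∈Box (B ⊗ C)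
∈⊗⁺ {a} B C {p} pˡ∈ pʳ∈ i with splitAt a i in eq
... | inj₁ i′ = subst (λ k → p k ∈ B i′) (splitAt⁻¹-↑ˡ eq) (pˡ∈ i′)
... | inj₂ i′ = subst (λ k → p k ∈ C i′) (splitAt⁻¹-↑ʳ eq) (pʳ∈ i′)

⊗-coordinatewise : ∀ {a b} (Q : Subset 5 → Set) (B : Box a) (C : Box b) →
                   (∀ i → Q (B i)) → (∀ i → Q (C i)) → ∀ i → Q ((B ⊗ C) i)
⊗-coordinatewise {a} Q B C QB QC i with splitAt a i
... | inj₁ i′ = QB i′
... | inj₂ i′ = QC i′

-- Fin (m * n) encodes pairs (j , l) of indices j : Fin m and l : Fin n.
firstIndex : ∀ {m} n → Fin (m * n) → Fin m
firstIndex {m} n k = proj₁ (remQuot {m} n k)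

secondIndex : ∀ {m} n → Fin (m * n) → Fin n
secondIndex {m} n k = proj₂ (remQuot {m} n k)

_⊠_ : ∀ {a b m n} → (Fin m → Box a) → (Fin n → Box b) → Fin (m * n) → Box (a + b)
_⊠_ {m = m} {n = n} F G k = F (firstIndex {m} n k) ⊗ G (secondIndex {m} n k)

⊠-partition : ∀ {a b m n} (F : Fin m → Box a) (G : Fin n → Box b) →
              IsPartition F → IsPartition G → IsPartition {a + b} (F ⊠ G)
⊠-partition {a} {b} {m} {n} F G (coverF , disjointF) (coverG , disjointG) =
  cover , disjoint
  where
  cover : ∀ p → ∃[ k ] (p ∈Box (F ⊠ G) k)
  cover p with coverF (left {a} p) | coverG (right {a} p)
  ... | j , pˡ∈ | l , pʳ∈ =
    combine j l ,
    subst (λ r → p ∈Box (F (proj₁ r) ⊗ G (proj₂ r))) (sym (remQuot-combine j l))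
      (∈⊗⁺ (F j) (G l) pˡ∈ pʳ∈)
  disjoint : ∀ p (k k′ : Fin (m * n)) → p ∈Box (F ⊠ G) k → p ∈Box (F ⊠ G) k′ → k ≡ k′
  disjoint p k k′ p∈k p∈k′ = begin
    k                                                    ≡⟨ combine-remQuot {m} n k ⟨
    combine (firstIndex {m} n k) (secondIndex {m} n k)   ≡⟨ cong₂ combine sameFirst sameSecond ⟩
    combine (firstIndex {m} n k′) (secondIndex {m} n k′) ≡⟨ combine-remQuot {m} n k′ ⟩
    k′                                                   ∎
    where
    open ≡-Reasoning
    sameFirst : firstIndex {m} n k ≡ firstIndex {m} n k′
    sameFirst = disjointF (left {a} p) _ _ (proj₁ (∈⊗⁻ _ _ p∈k)) (proj₁ (∈⊗⁻ _ _ p∈k′))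
    sameSecond : secondIndex {m} n k ≡ secondIndex {m} n k′
    sameSecond = disjointG (right {a} p) _ _ (proj₂ (∈⊗⁻ _ _ p∈k)) (proj₂ (∈⊗⁻ _ _ p∈k′))

⊠-oddProperPartition : ∀ {a b m n} → OddProperPartition a m → OddProperPartition b n →
                       OddProperPartition (a + b) (m * n)
⊠-oddProperPartition {m = m} {n = n} (F , partF , oddF , properF) (G , partG , oddG , properG) =
  F ⊠ G , ⊠-partition F G partF partG ,
  (λ k → ⊗-coordinatewise (λ S → Odd ∣ S ∣) _ _ (oddF (firstIndex {m} n k)) (oddG (secondIndex {m} n k))) ,
  (λ k → ⊗-coordinatewise (λ S → S ≢ ⊤) _ _ (properF (firstIndex {m} n k)) (properG (secondIndex {m} n k)))

-- [5]^0 is a single point, partitioned by its unique (empty-product) box;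
-- the conditions on coordinates hold vacuously.
trivialPartition : OddProperPartition 0 1
trivialPartition =
  (λ _ ()) , ((λ _ → zero , λ ()) , λ { _ zero zero _ _ → refl }) , (λ _ ()) , (λ _ ())

power : ∀ {a m} → OddProperPartition a m → ∀ q → OddProperPartition (q * a) (m ^ q)
power P zero    = trivialPartition
power P (suc q) = ⊠-oddProperPartition P (power P q)

odd? : ∀ n → Dec (Odd n)
odd? zero          = no λ { (_ , ()) }
odd? (suc zero)    = yes (0 , refl)
odd? (suc (suc n)) = map′ plusTwo minusTwo (odd? n)
  where
  plusTwo : Odd n → Odd (suc (suc n))
  plusTwo (m , n≡) = suc m , trans (cong (2 +_) n≡) (sym (cong suc (*-suc 2 m)))
  minusTwo : Odd (suc (suc n)) → Odd n
  minusTwo (zero  , ())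
  minusTwo (suc m , n≡) =
    m , suc-injective (suc-injective (trans n≡ (cong suc (*-suc 2 m))))

_∈Box?_ : ∀ {d} (p : Point d) (B : Box d) → Dec (p ∈Box B)
p ∈Box? B = all? λ i → p i ∈? B i

-- A property of points that only depends on their coordinates.  (Without
-- function extensionality this has to be assumed explicitly.)
Extensional : ∀ {d} → (Point d → Set) → Set
Extensional {d} P = ∀ {p q : Point d} → (∀ i → p i ≡ q i) → P p → P q

-- Quantification over the finite set [5]^d preserves decidability: a point
-- of [5]^(d+1) is a first coordinate followed by a point of [5]^d.
allPoints? : ∀ {d} (P : Point d → Set) → Extensional P → (∀ p → Dec (P p)) →
             Dec (∀ p → P p)
allPoints? {zero}  P ext P? = map′ (λ Pₒ p → ext (λ ()) Pₒ) (λ ∀P → ∀P origin) (P? origin)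
  where
  origin : Point 0
  origin ()
allPoints? {suc d} P ext P? =
  map′ (λ ∀P p → ext headTail (∀P (p zero) (Point.tail p))) (λ ∀P x t → ∀P (x Point.∷ t))
       (all? λ x → allPoints? (λ t → P (x Point.∷ t)) (λ t≗ → ext (cons-cong t≗))
                              (λ t → P? (x Point.∷ t)))
  where
  headTail : ∀ {p : Point (suc d)} i → (p zero Point.∷ Point.tail p) i ≡ p i
  headTail zero    = refl
  headTail (suc i) = refl
  cons-cong : ∀ {x} {t u : Point d} → (∀ i → t i ≡ u i) → ∀ i → (x Point.∷ t) i ≡ (x Point.∷ u) i
  cons-cong t≗ zero    = refl
  cons-cong t≗ (suc i) = t≗ i

∈Box-ext : ∀ {d} (B : Box d) → Extensional (_∈Box B)
∈Box-ext B p≗q p∈ i = subst (_∈ B i) (p≗q i) (p∈ i)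

-- Disjointness is tested pointwise in the curried form OnlyOneBox, so that
-- for each point the boxes not containing it are discarded at once.
isOddProperPartition? : ∀ {d m} (F : Fin m → Box d) →
  Dec (IsPartition F × (∀ j → OddBox (F j)) × (∀ j → Proper (F j)))
isOddProperPartition? {d} {m} F =
  (cover? ×-dec disjoint?) ×-dec (all? (λ j → all? λ i → odd? ∣ F j i ∣)
                                  ×-dec all? (λ j → all? λ i → ¬? (F j i ≟ˢ ⊤)))
  where
  _≟ˢ_ : (S T : Subset 5) → Dec (S ≡ T)
  _≟ˢ_ = ≡-dec _≟ᵇ_

  cover? : Dec (∀ p → ∃[ j ] (p ∈Box F j))
  cover? = allPoints? _ (λ p≗q (j , p∈) → j , ∈Box-ext (F j) p≗q p∈)
                        (λ p → any? λ j → p ∈Box? F j)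

  OnlyOneBox : Point d → Set
  OnlyOneBox p = ∀ j → p ∈Box F j → ∀ k → p ∈Box F k → j ≡ k

  onlyOneBox? : ∀ p → Dec (OnlyOneBox p)
  onlyOneBox? p = all? λ j → (p ∈Box? F j) →-dec all? λ k → (p ∈Box? F k) →-dec (j ≟ k)

  onlyOneBox-ext : Extensional OnlyOneBox
  onlyOneBox-ext p≗q one j q∈j k q∈k =
    one j (∈Box-ext (F j) (sym ∘ p≗q) q∈j) k (∈Box-ext (F k) (sym ∘ p≗q) q∈k)

  disjoint? : Dec (∀ p (j k : Fin m) → p ∈Box F j → p ∈Box F k → j ≡ k)
  disjoint? = map′ (λ one p j k p∈j p∈k → one p j p∈j k p∈k)
                   (λ disj p j p∈j k p∈k → disj p j k p∈j p∈k)
                   (allPoints? OnlyOneBox onlyOneBox-ext onlyOneBox?)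

-- Notation for subsets of [5] by their membership pattern, e.g.
-- ■ □ ■ ■ □ · is {1, 3, 4}, and for boxes B₁ × B₂ × B₃ ⊆ [5]^3.
infixr 6 ■_ □_
■_ □_ : ∀ {n} → Subset n → Subset (suc n)
■_ = inside ∷_
□_ = outside ∷_

· : Subset 0
· = []

⟪_,_,_⟫ : Subset 5 → Subset 5 → Subset 5 → Box 3
⟪ B₁ , B₂ , B₃ ⟫ = lookup (B₁ ∷ B₂ ∷ B₃ ∷ [])

baseBoxes : Vec (Box 3) 25
baseBoxes =
  ⟪ ■ □ □ □ □ · , ■ ■ ■ □ □ · , ■ ■ ■ □ □ · ⟫ ∷
  ⟪ □ ■ □ □ □ · , ■ □ □ □ □ · , ■ ■ ■ □ □ · ⟫ ∷
  ⟪ □ ■ □ □ □ · , □ ■ □ □ □ · , ■ ■ ■ □ □ · ⟫ ∷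
  ⟪ □ ■ □ □ □ · , □ □ ■ ■ ■ · , ■ ■ ■ □ □ · ⟫ ∷
  ⟪ □ □ ■ ■ ■ · , ■ □ □ □ □ · , ■ ■ ■ □ □ · ⟫ ∷
  ⟪ □ □ ■ ■ ■ · , □ ■ □ □ □ · , ■ □ □ ■ ■ · ⟫ ∷
  ⟪ □ □ □ □ ■ · , □ □ □ □ ■ · , □ ■ □ ■ ■ · ⟫ ∷
  ⟪ □ □ □ ■ □ · , □ □ □ ■ □ · , □ □ ■ ■ ■ · ⟫ ∷
  ⟪ ■ □ □ □ □ · , □ □ □ □ ■ · , ■ □ ■ ■ □ · ⟫ ∷
  ⟪ ■ □ □ □ □ · , □ □ □ ■ □ · , ■ ■ □ □ ■ · ⟫ ∷
  ⟪ □ □ ■ ■ ■ · , □ □ ■ ■ ■ · , ■ □ □ □ □ · ⟫ ∷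
  ⟪ □ □ ■ ■ ■ · , □ ■ ■ ■ □ · , □ ■ □ □ □ · ⟫ ∷
  ⟪ ■ □ ■ ■ □ · , □ □ □ □ ■ · , □ ■ □ □ □ · ⟫ ∷
  ⟪ □ □ ■ ■ ■ · , □ ■ ■ □ ■ · , □ □ ■ □ □ · ⟫ ∷
  ⟪ ■ □ ■ □ ■ · , □ □ □ ■ □ · , □ □ ■ □ □ · ⟫ ∷
  ⟪ □ ■ □ □ □ · , □ ■ □ □ □ · , □ □ □ ■ □ · ⟫ ∷
  ⟪ □ □ □ □ ■ · , ■ □ ■ ■ □ · , □ □ □ ■ □ · ⟫ ∷
  ⟪ □ ■ ■ ■ □ · , ■ □ ■ □ ■ · , □ □ □ ■ □ · ⟫ ∷
  ⟪ ■ □ □ □ □ · , ■ ■ ■ □ □ · , □ □ □ ■ □ · ⟫ ∷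
  ⟪ ■ ■ ■ □ □ · , □ □ □ ■ □ · , □ □ □ ■ □ · ⟫ ∷
  ⟪ □ ■ □ □ □ · , □ ■ □ □ □ · , □ □ □ □ ■ · ⟫ ∷
  ⟪ □ □ □ ■ □ · , ■ □ ■ □ ■ · , □ □ □ □ ■ · ⟫ ∷
  ⟪ □ ■ ■ □ ■ · , ■ □ ■ ■ □ · , □ □ □ □ ■ · ⟫ ∷
  ⟪ ■ □ □ □ □ · , ■ ■ ■ □ □ · , □ □ □ □ ■ · ⟫ ∷
  ⟪ ■ ■ ■ □ □ · , □ □ □ □ ■ · , □ □ □ □ ■ · ⟫ ∷
  []

-- The partition property, oddness and properness of these boxes are
-- confirmed by running the decision procedure.
basePartition : OddProperPartition 3 25
basePartition = lookup baseBoxes , toWitness {a? = isOddProperPartition? (lookup baseBoxes)} _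

theorem1p3 : (d : ℕ) → d > 0 → 3 ∣ d →
    ∃[ F ] (IsPartition {d} {25 ^ (d / 3)} F ×
            (∀ j → OddBox (F j)) × (∀ j → Proper (F j)))
theorem1p3 .(q * 3) _ (divides q refl) =
  subst (λ e → OddProperPartition (q * 3) (25 ^ e)) (sym (m*n/n≡m q 3)) (power basePartition q)
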